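{- Let $p,u$ be PPC terms, $\theta$ a list of symbols and $V,M$ lists of lists of symbols for which the translations below are defined. Then: (1) if $\{p/u\}_\theta=\sigma$ is a substitution, then $\mathcal T_{V,M}(\{p/u\}_\theta)=\mathcal T_{V,M}(\sigma)_\theta$; (2) if $\{p/u\}_\theta=\mathtt{fail}$, then $\mathcal T_{V,M}(\{p/u\}_\theta)=\mathtt{fail}$; (3) if $\{p/u\}_\theta=\mathtt{wait}$, then $\mathcal T_{V,M}(\{p/u\}_\theta)=\mathtt{wait}$.
   Context: **PPC.** PPC terms over a set of symbols: $t::=x\mid\hat x\mid t\,t\mid\lambda_\theta p.s$. Data structures are $d::=\hat x\mid d\,t$; matchable forms are $m::=d\mid\lambda_\theta t.t$. A match is a substitution (finite partial map from symbols to terms), $\mathtt{fail}$ or $\mathtt{wait}$. $\mu\uplus\mu'$ is $\mathtt{fail}$ if either match is $\mathtt{fail}$; else $\mathtt{wait}$ if either is $\mathtt{wait}$; else $\mathtt{fail}$ if the domains intersect; else the union. PPC matching $\{p/u\}_\theta$ (first applicable clause): 1. $\{\hat x/u\}_\theta=\{x\mapsto u\}$ if $x\in\theta$; 2. $\{\hat x/\hat x\}_\theta=\{\}$ if $x\notin\theta$; 3. $\{p\,q/t\,u\}_\theta=\{p/t\}_\theta\uplus\{q/u\}_\theta$ if $p\,q,t\,u$ are matchable forms; 4. $\mathtt{fail}$ if $p,u$ are matchable forms; 5. $\mathtt{wait}$ otherwise. A substitution result with domain different from $\theta$ becomes $\mathtt{fail}$. **PPC_dB.** PPC_dB terms: $t::=\mathsf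 v_{i,j}\mid\mathsf m_{i,j}\mid t\,t\mid\lambda_np.s$. Data structures are $d::=\mathsf m_{i,j}\mid d\,t$; matchable forms are $m::=d\mid\lambda_nt.t$. PPC_dB matching $\{p/u\}_n$: $\{\mathsf m_{1,j}/u\}_n=\{\mathsf v_{1,j}\mapsto u\}$; $\{\mathsf m_{i+1,j}/\mathsf m_{i,j}\}_n=\{\}$; then the application, $\mathtt{fail}$ and $\mathtt{wait}$ clauses as in PPC (with $\uplus$ defined analogously). A substitution result with domain different from $\{\mathsf v_{1,1},\dots,\mathsf v_{1,n}\}$ becomes $\mathtt{fail}$. **Translation.** For lists of lists of symbols $V,M$ ($V_{ij}$ is the $j$-th element of the $i$-th list; $\theta++V=[\theta]++V$): - $\mathcal T_{V,M}(x)=\mathsf v_{i,j}$ with $i=\min\{i'\mid x\in V_{i'}\}$ and $j=\min\{j'\mid x=V_{ij'}\}$; - $\mathcal T_{V,M}(\hat x)=\mathsf m_{i,j}$, likewise using $M$; - homomorphic on applications; - $\mathcal T_{V,M}(\lambda_\theta p.s)=\lambda_{|\theta|}\mathcal T_{V,\theta++M}(p).\mathcal T_{\theta++V,M}(s)$. Translations of substitutions and matches: - For a substitution $\sigma$ and an enumeration $\theta=[x_1,\dots,x_m]$ with $dom(\sigma)\subseteq\theta$: $\mathcal T_{V,M}(\sigma)_\theta=\{\mathsf v_{1,j}\mapsto\mathcal T_{V,M}(\sigma(x_j))\}_{x_j\in dom(\sigma)}$. - The translation of a match is $\mathcal T_{V,M}(\{p/u\}_\theta):=\{\mathcal T_{V,\theta++M}(p)/\mathcal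 T_{V,M}(u)\}_{|\theta|}$, a PPC_dB matching. -}

module Defs where

open import Data.Nat using (ℕ; zero; suc)
import Data.Nat as ℕ
open import Data.Bool using (Bool; true; false; if_then_else_; _∧_; _∨_; not)
open import Data.List using (List; []; _∷_; _++_; length; map)
open import Data.Bool.ListAction using (any; all)
open import Data.Maybe using (Maybe; just; nothing)
open import Data.Product using (_×_; _,_; proj₁)
open import Relation.Nullary.Decidable using (⌊_⌋)
open import Relation.Binary.Definitions using (DecidableEquality)
open import Relation.Binary.PropositionalEquality using (_≡_)
open import Data.Product.Properties using () renaming (≡-dec to ×-≡-dec)

-- Symbols are natural numbers (any countable set with decidable
-- equality would do).

Symbol : Set
Symbol = ℕ

data Term : Set where
  var : Symbol → Term
  mat : Symbol → Term                 -- x̂  (matchable symbol)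
  app : Term → Term → Term
  lam : List Symbol → Term → Term → Term

-- PPC_dB terms:  t ::= v_{i,j} | m_{i,j} | t t | λ_n p.s  (indices 1-based)

data DTerm : Set where
  v   : ℕ → ℕ → DTerm
  m   : ℕ → ℕ → DTerm
  app : DTerm → DTerm → DTerm
  lam : ℕ → DTerm → DTerm → DTerm

-- Matches (generic over the key type of substitutions).
-- A substitution is a finite partial map, represented by an
-- association list; its meaning is given by 'lookupK' (first binding).

data Match (K T : Set) : Set where
  fail : Match K T
  wait : Match K T
  sub  : List (K × T) → Match K T

module _ {K T : Set} (_≟_ : DecidableEquality K) where

  memK : K → List K → Bool
  memK k ks = any (λ k' → ⌊ k ≟ k' ⌋) ks

  keys : List (K × T) → List K
  keys = map proj₁

  lookupK : List (K × T) → K → Maybe T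
  lookupK [] k = nothing
  lookupK ((k' , t) ∷ s) k = if ⌊ k ≟ k' ⌋ then just t else lookupK s k

  intersects : List (K × T) → List (K × T) → Bool
  intersects s t = any (λ k → memK k (keys t)) (keys s)

  union : Match K T → Match K T → Match K T
  union fail    _       = fail
  union (sub _) fail    = fail
  union wait    fail    = fail
  union wait    _       = wait
  union (sub _) wait    = wait
  union (sub s) (sub t) = if intersects s t then fail else sub (s ++ t)

  sameDom : List (K × T) → List K → Bool
  sameDom s ks = all (λ k → memK k ks) (keys s) ∧ all (λ k → memK k (keys s)) ks

  checkDom : List K → Match K T → Match K T
  checkDom ks (sub s) = if sameDom s ks then sub s else fail
  checkDom ks μ       = μ

  data _≈M_ : Match K T → Match K T → Set where
    fail≈ : fail ≈M fail
    wait≈ : wait ≈M wait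
    sub≈  : ∀ {s t} → (∀ k → lookupK s k ≡ lookupK t k) → sub s ≈M sub t

PMatch : Set
PMatch = Match Symbol Term

isDataP : Term → Bool
isDataP (mat _)   = true
isDataP (app d _) = isDataP d
isDataP _         = false

isMatchableP : Term → Bool
isMatchableP (lam _ _ _) = true
isMatchableP t           = isDataP t

memS : Symbol → List Symbol → Bool
memS = memK {T = Term} ℕ._≟_

rawMatch : List Symbol → Term → Term → PMatch
rawMatch θ (mat x) u with memS x θ
... | true = sub ((x , u) ∷ [])
rawMatch θ (mat x) (mat y) | false with ⌊ x ℕ.≟ y ⌋
... | true = sub []
... | false = fail
rawMatch θ (mat x) u | false = if isMatchableP u then fail else wait
rawMatch θ (app p q) (app t u) =
  if isMatchableP (app p q) ∧ isMatchableP (app t u)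
  then union ℕ._≟_ (rawMatch θ p t) (rawMatch θ q u)
  else wait
rawMatch θ p u = if isMatchableP p ∧ isMatchableP u then fail else wait

match : List Symbol → Term → Term → PMatch
match θ p u = checkDom ℕ._≟_ θ (rawMatch θ p u)

DKey : Set
DKey = ℕ × ℕ      -- (i , j) stands for v_{i,j}

DMatch : Set
DMatch = Match DKey DTerm

dkey-≟ : DecidableEquality DKey
dkey-≟ = ×-≡-dec ℕ._≟_ ℕ._≟_

isDataD : DTerm → Bool
isDataD (m _ _)   = true
isDataD (app d _) = isDataD d
isDataD _         = false

isMatchableD : DTerm → Bool
isMatchableD (lam _ _ _) = true
isMatchableD t           = isDataD t

rawMatchD : ℕ → DTerm → DTerm → DMatch
rawMatchD n (m 1 j) u = sub (((1 , j) , u) ∷ [])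
rawMatchD n (m (suc (suc i)) j) (m i' j') with ⌊ suc i ℕ.≟ i' ⌋ ∧ ⌊ j ℕ.≟ j' ⌋
... | true  = sub []
... | false = fail
rawMatchD n (app p q) (app t u) =
  if isMatchableD (app p q) ∧ isMatchableD (app t u)
  then union dkey-≟ (rawMatchD n p t) (rawMatchD n q u)
  else wait
rawMatchD n p u = if isMatchableD p ∧ isMatchableD u then fail else wait

firstKeys : ℕ → List DKey
firstKeys zero    = []
firstKeys (suc n) = firstKeys n ++ ((1 , suc n) ∷ [])

matchD : ℕ → DTerm → DTerm → DMatch
matchD n p u = checkDom dkey-≟ (firstKeys n) (rawMatchD n p u)

-- 1-based position of the first occurrence of x in a list
indexOf : Symbol → List Symbol → Maybe ℕ
indexOf x [] = nothing
indexOf x (y ∷ ys) with ⌊ x ℕ.≟ y ⌋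
... | true  = just 1
... | false with indexOf x ys
...   | just j  = just (suc j)
...   | nothing = nothing

index2 : Symbol → List (List Symbol) → Maybe (ℕ × ℕ)
index2 x [] = nothing
index2 x (L ∷ Ls) with indexOf x L
... | just j = just (1 , j)
... | nothing with index2 x Ls
...   | just (i , j) = just (suc i , j)
...   | nothing      = nothing

transl : List (List Symbol) → List (List Symbol) → Term → Maybe DTerm
transl V M (var x) with index2 x V
... | just (i , j) = just (v i j)
... | nothing      = nothing
transl V M (mat x) with index2 x M
... | just (i , j) = just (m i j)
... | nothing      = nothing
transl V M (app t u) with transl V M t | transl V M u
... | just t' | just u' = just (app t' u')
... | _       | _       = nothing
transl V M (lam θ p s) with transl V (θ ∷ M) p | transl (θ ∷ V) M s
... | just p' | just s' = just (lam (length θ) p' s')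
... | _       | _       = nothing

-- T_{V,M}(σ)_θ = { v_{1,j} ↦ T_{V,M}(σ(x_j)) }_{x_j ∈ dom σ}
-- (nothing if some T_{V,M}(σ(x_j)) is undefined)
transSubAux : List (List Symbol) → List (List Symbol) →
              List (Symbol × Term) → ℕ → List Symbol → Maybe (List (DKey × DTerm))
transSubAux V M σ j [] = just []
transSubAux V M σ j (x ∷ θ) with lookupK ℕ._≟_ σ x
... | nothing = transSubAux V M σ (suc j) θ
... | just t with transl V M t | transSubAux V M σ (suc j) θ
...   | just t' | just τ = just (((1 , j) , t') ∷ τ)
...   | _       | _      = nothing

transSub : List (List Symbol) → List (List Symbol) →
           List (Symbol × Term) → List Symbol → Maybe (List (DKey × DTerm))
transSub V M σ θ = transSubAux V M σ 1 θ

-- A PPC match and a PPC_dB match are related by TrMatch when both fail,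
-- both wait, or the second is the entrywise translation of the first
-- (TrSub: x ↦ t becomes v_{1,j} ↦ T_{V,M}(t), j the position of x in θ).
--  (1) simulate: induction on the graph Tr of the translation shows that
--      raw matching of translated terms is TrMatch-related to raw matching;
--      it uses that T preserves data structures and matchable forms, that
--      positions of symbols are compared exactly when the symbols are, and
--      that ⊎ commutes with translation.
--  (2) TrMatch-checkDom: the domain checks agree, as σ binds all of θ iff
--      its translation binds v_{1,1}, …, v_{1,|θ|}.
--  (3) TrSub≈transSub: the translation of σ coincides with T_{V,M}(σ)_θ,
--      both being the finite map `expected`.
module Submission where

open import Data.Bool using (Bool; true; false; if_then_else_; _∧_; _∨_; T)
open import Data.Bool.ListAction using (all)
open import Data.Bool.Properties using (T-∧; T-≡)
open import Data.Empty using (⊥-elim)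
open import Data.List using (List; []; _∷_; _++_; length)
open import Data.List.Membership.Propositional using (_∈_; _∉_)
open import Data.List.Membership.Propositional.Properties using (∈-++⁺ˡ; ∈-++⁺ʳ; ∈-++⁻)
open import Data.List.Relation.Binary.Subset.Propositional using (_⊆_)
open import Data.List.Relation.Unary.All as All using ()
open import Data.List.Relation.Unary.All.Properties using (all⁺; all⁻)
open import Data.List.Relation.Unary.Any as Any using (here; there)
open import Data.List.Relation.Unary.Any.Properties using (any⁺; any⁻)
open import Data.List.Relation.Unary.AllPairs using (_∷_)
open import Data.List.Relation.Unary.Unique.Propositional using (Unique)
open import Data.Maybe using (Maybe; just; nothing; _>>=_)
import Data.Maybe as Maybe
open import Data.Maybe.Properties using (just-injective)
open import Data.Nat using (ℕ; zero; suc; _≡ᵇ_; _≤_; _<_; z≤n; s≤s)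
import Data.Nat as ℕ
open import Data.Nat.Properties using (≡ᵇ⇒≡; ≡⇒≡ᵇ; <-irrefl; ≤-refl; m<n⇒m<1+n; m≤n⇒m≤1+n; m≤n⇒m<n∨m≡n)
open import Data.Product using (_×_; _,_; proj₂; ∃-syntax)
open import Data.Sum using (_⊎_; inj₁; inj₂)
open import Defs
open import Function using (_∘_; _⇔_; mk⇔; Equivalence)
open import Function.Properties.Equivalence using () renaming (sym to ⇔-sym; trans to ⇔-trans)
open import Relation.Binary.Definitions using (DecidableEquality)
open import Relation.Binary.PropositionalEquality
open ≡-Reasoning
open import Relation.Nullary using (Dec; yes; no; ¬_)
open import Relation.Nullary.Decidable using (⌊_⌋; toWitness; fromWitness; does-⇔; T?)

open Equivalence using (to; from)

if-true : ∀ {A : Set} {b} {x y : A} → T b → (if b then x else y) ≡ x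
if-true {b = true} _ = refl

if-false : ∀ {A : Set} {b} {x y : A} → ¬ T b → (if b then x else y) ≡ y
if-false {b = false} _  = refl
if-false {b = true}  ¬t = ⊥-elim (¬t _)

T-injective : ∀ {a b} → T a ⇔ T b → a ≡ b
T-injective {a} {b} a⇔b = does-⇔ a⇔b (T? a) (T? b)

module KeyLists {K A : Set} (_≟_ : DecidableEquality K) where

  memK⇔∈ : ∀ {k ks} → T (memK {T = A} _≟_ k ks) ⇔ k ∈ ks
  memK⇔∈ = mk⇔ (Any.map toWitness ∘ any⁻ _ _) (any⁺ _ ∘ Any.map fromWitness)

  memK-true : ∀ {k ks} → k ∈ ks → memK {T = A} _≟_ k ks ≡ true
  memK-true = to T-≡ ∘ from memK⇔∈

  memK-false : ∀ {k ks} → k ∉ ks → memK {T = A} _≟_ k ks ≡ false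
  memK-false {k} {ks} k∉ks with memK {T = A} _≟_ k ks in eq
  ... | false = refl
  ... | true  = ⊥-elim (k∉ks (to memK⇔∈ (from T-≡ eq)))

  lookupK-here : ∀ {k} {t : A} s → lookupK _≟_ ((k , t) ∷ s) k ≡ just t
  lookupK-here {k} s = if-true (fromWitness {a? = k ≟ k} refl)

  lookupK-there : ∀ {k k′} {t : A} s → k ≢ k′ → lookupK _≟_ ((k′ , t) ∷ s) k ≡ lookupK _≟_ s k
  lookupK-there {k} {k′} s k≢k′ = if-false (k≢k′ ∘ toWitness {a? = k ≟ k′})

  allMem⇔⊆ : ∀ {xs ks} → T (all (λ k → memK {T = A} _≟_ k ks) xs) ⇔ xs ⊆ ks
  allMem⇔⊆ {xs} {ks} = mk⇔ memAll⇒⊆ ⊆⇒memAll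
    where
    mem : K → Bool
    mem k = memK {T = A} _≟_ k ks
    memAll⇒⊆ : T (all mem xs) → xs ⊆ ks
    memAll⇒⊆ h k∈xs = to memK⇔∈ (All.lookup (all⁺ mem xs h) k∈xs)
    ⊆⇒memAll : xs ⊆ ks → T (all mem xs)
    ⊆⇒memAll xs⊆ks = all⁻ mem (All.tabulate (λ k∈xs → from memK⇔∈ (xs⊆ks k∈xs)))

  sameDom⇔ : ∀ {s : List (K × A)} {ks} → T (sameDom _≟_ s ks) ⇔ (keys _≟_ s ⊆ ks × ks ⊆ keys _≟_ s)
  sameDom⇔ {s} {ks} = mk⇔ sameDom⇒ ⇒sameDom
    where
    sameDom⇒ : T (sameDom _≟_ s ks) → keys _≟_ s ⊆ ks × ks ⊆ keys _≟_ s
    sameDom⇒ h = let a , b = to T-∧ h in to allMem⇔⊆ a , to allMem⇔⊆ b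
    ⇒sameDom : keys _≟_ s ⊆ ks × ks ⊆ keys _≟_ s → T (sameDom _≟_ s ks)
    ⇒sameDom (a , b) = from T-∧ (from allMem⇔⊆ a , from allMem⇔⊆ b)

module SymKeys = KeyLists {Symbol} {Term} ℕ._≟_
module DKeys   = KeyLists {DKey} {DTerm} dkey-≟

-- nthFrom j₀ xs j is the entry of xs at position j, positions being
-- numbered from j₀; nthFrom 1 inverts indexOf and, row by row, index2.
nthFrom : {A : Set} → ℕ → List A → ℕ → Maybe A
nthFrom j₀ []       j = nothing
nthFrom j₀ (x ∷ xs) j = if j ≡ᵇ j₀ then just x else nthFrom (suc j₀) xs j

nthFrom-suc : {A : Set} (j₀ : ℕ) (xs : List A) (j : ℕ) → nthFrom (suc j₀) xs (suc j) ≡ nthFrom j₀ xs j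
nthFrom-suc j₀ []       j = refl
nthFrom-suc j₀ (x ∷ xs) j with j ≡ᵇ j₀
... | true  = refl
... | false = nthFrom-suc (suc j₀) xs j

nthFrom-below : {A : Set} (j₀ : ℕ) (xs : List A) (j : ℕ) → j < j₀ → nthFrom j₀ xs j ≡ nothing
nthFrom-below j₀ []       j j<j₀ = refl
nthFrom-below j₀ (x ∷ xs) j j<j₀ =
  trans (if-false (λ j≡j₀ → <-irrefl (≡ᵇ⇒≡ j j₀ j≡j₀) j<j₀))
        (nthFrom-below (suc j₀) xs j (m<n⇒m<1+n j<j₀))

nthFrom-defined : {A : Set} (xs : List A) (j : ℕ) → 1 ≤ j → j ≤ length xs → ∃[ x ] nthFrom 1 xs j ≡ just x
nthFrom-defined (x ∷ xs) 1             _ _         = x , refl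
nthFrom-defined (x ∷ xs) (suc (suc j)) _ (s≤s j<∣xs∣) =
  let y , e = nthFrom-defined xs (suc j) (s≤s z≤n) j<∣xs∣ in y , trans (nthFrom-suc 1 xs (suc j)) e

indexOf-here : ∀ x ys → indexOf x (x ∷ ys) ≡ just 1
indexOf-here x ys with x ℕ.≟ x
... | yes _  = refl
... | no x≢x = ⊥-elim (x≢x refl)

indexOf-there : ∀ {x y} ys → x ≢ y → indexOf x (y ∷ ys) ≡ Maybe.map suc (indexOf x ys)
indexOf-there {x} {y} ys x≢y with x ℕ.≟ y
... | yes x≡y = ⊥-elim (x≢y x≡y)
... | no _ with indexOf x ys
...   | just j  = refl
...   | nothing = refl

indexOf-bounds : ∀ x xs {j} → indexOf x xs ≡ just j → 1 ≤ j × j ≤ length xs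
indexOf-bounds x (y ∷ ys) e with x ℕ.≟ y
indexOf-bounds x (y ∷ ys) refl | yes _ = s≤s z≤n , s≤s z≤n
... | no _ with indexOf x ys in e′
indexOf-bounds x (y ∷ ys) refl | no _ | just j = s≤s z≤n , s≤s (proj₂ (indexOf-bounds x ys e′))

indexOf⇒∈ : ∀ x xs {j} → indexOf x xs ≡ just j → x ∈ xs
indexOf⇒∈ x (y ∷ ys) e with x ℕ.≟ y
... | yes refl = here refl
... | no _ with indexOf x ys in e′
indexOf⇒∈ x (y ∷ ys) refl | no _ | just j = there (indexOf⇒∈ x ys e′)

∈⇒indexOf : ∀ {x xs} → x ∈ xs → ∃[ j ] indexOf x xs ≡ just j
∈⇒indexOf {x} {y ∷ ys} (here refl) = 1 , indexOf-here x ys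
∈⇒indexOf {x} {y ∷ ys} (there x∈ys) = later (x ℕ.≟ y)
  where
  later : Dec (x ≡ y) → ∃[ j ] indexOf x (y ∷ ys) ≡ just j
  later (yes refl) = 1 , indexOf-here x ys
  later (no x≢y)   =
    let j , e = ∈⇒indexOf x∈ys in suc j , trans (indexOf-there ys x≢y) (cong (Maybe.map suc) e)

indexOf-nothing⇒∉ : ∀ {x xs} → indexOf x xs ≡ nothing → x ∉ xs
indexOf-nothing⇒∉ e x∈xs with j , e′ ← ∈⇒indexOf x∈xs with () ← trans (sym e) e′

indexOf⇒nth : ∀ x xs {j} → indexOf x xs ≡ just j → nthFrom 1 xs j ≡ just x
indexOf⇒nth x (y ∷ ys) e with x ℕ.≟ y
indexOf⇒nth x (y ∷ ys) refl | yes refl = refl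
... | no _ with indexOf x ys in e′
indexOf⇒nth x (y ∷ ys) refl | no _ | just j with indexOf-bounds x ys e′
... | s≤s z≤n , _ = trans (nthFrom-suc 1 ys j) (indexOf⇒nth x ys e′)

nth⇒indexOf : ∀ {x xs} → Unique xs → ∀ j → nthFrom 1 xs j ≡ just x → indexOf x xs ≡ just j
nth⇒indexOf {xs = y ∷ ys} _ zero e with () ← trans (sym e) (nthFrom-below 2 ys 0 (s≤s z≤n))
nth⇒indexOf {xs = y ∷ ys} _ 1 refl = indexOf-here y ys
nth⇒indexOf {x} {y ∷ ys} (y∉ys ∷ uq) (suc (suc j)) e =
  trans (indexOf-there ys x≢y) (cong (Maybe.map suc) x-in-ys)
  where
  x-in-ys : indexOf x ys ≡ just (suc j)
  x-in-ys = nth⇒indexOf uq (suc j) (trans (sym (nthFrom-suc 1 ys (suc j))) e)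
  x≢y : x ≢ y
  x≢y x≡y = All.lookup y∉ys (indexOf⇒∈ x ys x-in-ys) (sym x≡y)

indexOf-injective : ∀ xs {x y j} → indexOf x xs ≡ just j → indexOf y xs ≡ just j → x ≡ y
indexOf-injective xs {x} {y} ex ey = just-injective (trans (sym (indexOf⇒nth x xs ex)) (indexOf⇒nth y xs ey))

indexOf-surjective : ∀ {xs} → Unique xs → ∀ j → 1 ≤ j → j ≤ length xs → ∃[ x ] indexOf x xs ≡ just j
indexOf-surjective {xs} uq j 1≤j j≤∣xs∣ =
  let x , e = nthFrom-defined xs j 1≤j j≤∣xs∣ in x , nth⇒indexOf uq j e

Ctx : Set
Ctx = List (List Symbol)

index2-positive : ∀ x Ls {i j} → index2 x Ls ≡ just (i , j) → ∃[ i₀ ] i ≡ suc i₀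
index2-positive x (L ∷ Ls) e with indexOf x L
index2-positive x (L ∷ Ls) refl | just j = 0 , refl
... | nothing with index2 x Ls
index2-positive x (L ∷ Ls) refl | nothing | just (i , j) = i , refl

index2-cons : ∀ x L Ls {i j} → index2 x (L ∷ Ls) ≡ just (i , j) →
  (indexOf x L ≡ just j × i ≡ 1) ⊎
  (indexOf x L ≡ nothing × ∃[ i₀ ] index2 x Ls ≡ just (suc i₀ , j) × i ≡ suc (suc i₀))
index2-cons x L Ls e with indexOf x L in e₁
index2-cons x L Ls refl | just j = inj₁ (refl , refl)
... | nothing with index2 x Ls in e₂
index2-cons x L Ls refl | nothing | just (i , j) with index2-positive x Ls e₂
... | i₀ , refl = inj₂ (refl , i₀ , refl , refl)

nth₂ : Ctx → ℕ → ℕ → Maybe Symbol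
nth₂ Ls i j = nthFrom 1 Ls i >>= λ L → nthFrom 1 L j

index2⇒nth₂ : ∀ x Ls {i j} → index2 x Ls ≡ just (i , j) → nth₂ Ls i j ≡ just x
index2⇒nth₂ x (L ∷ Ls) e with index2-cons x L Ls e
... | inj₁ (e₁ , refl) = indexOf⇒nth x L e₁
... | inj₂ (_ , i₀ , e₂ , refl) =
  trans (cong (_>>= λ L′ → nthFrom 1 L′ _) (nthFrom-suc 1 Ls (suc i₀))) (index2⇒nth₂ x Ls e₂)

index2-injective : ∀ Ls {x y k} → index2 x Ls ≡ just k → index2 y Ls ≡ just k → x ≡ y
index2-injective Ls {x} {y} ex ey = just-injective (trans (sym (index2⇒nth₂ x Ls ex)) (index2⇒nth₂ y Ls ey))

firstKeys-∋ : ∀ n {j} → 1 ≤ j → j ≤ n → (1 , j) ∈ firstKeys n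
firstKeys-∋ zero    (s≤s _) ()
firstKeys-∋ (suc n) 1≤j j≤n with m≤n⇒m<n∨m≡n j≤n
... | inj₁ (s≤s j≤n′) = ∈-++⁺ˡ (firstKeys-∋ n 1≤j j≤n′)
... | inj₂ refl      = ∈-++⁺ʳ (firstKeys n) (here refl)

firstKeys-∈ : ∀ n {k} → k ∈ firstKeys n → ∃[ j ] k ≡ (1 , j) × 1 ≤ j × j ≤ n
firstKeys-∈ (suc n) k∈ with ∈-++⁻ (firstKeys n) k∈
... | inj₁ k∈′ = let j , k≡ , 1≤j , j≤n = firstKeys-∈ n k∈′ in j , k≡ , 1≤j , m≤n⇒m≤1+n j≤n
... | inj₂ (here refl) = suc n , refl , s≤s z≤n , ≤-refl

-- The graph of the translation T_{V,M}: Tr V M t t′ holds iff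
-- transl V M t ≡ just t′.  Unlike transl it can be inverted by
-- pattern matching, which drives the simulation proof below.
data Tr (V M : Ctx) : Term → DTerm → Set where
  var : ∀ {x i j} → index2 x V ≡ just (i , j) → Tr V M (var x) (v i j)
  mat : ∀ {x i j} → index2 x M ≡ just (i , j) → Tr V M (mat x) (m i j)
  app : ∀ {t u t′ u′} → Tr V M t t′ → Tr V M u u′ → Tr V M (app t u) (app t′ u′)
  lam : ∀ {θ p s p′ s′} → Tr V (θ ∷ M) p p′ → Tr (θ ∷ V) M s s′ →
        Tr V M (lam θ p s) (lam (length θ) p′ s′)

transl⇒Tr : ∀ V M t {t′} → transl V M t ≡ just t′ → Tr V M t t′
transl⇒Tr V M (var x) e with index2 x V in e₁
transl⇒Tr V M (var x) refl | just (i , j) = var e₁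
transl⇒Tr V M (mat x) e with index2 x M in e₁
transl⇒Tr V M (mat x) refl | just (i , j) = mat e₁
transl⇒Tr V M (app t u) e with transl V M t in e₁ | transl V M u in e₂
transl⇒Tr V M (app t u) refl | just _ | just _ = app (transl⇒Tr V M t e₁) (transl⇒Tr V M u e₂)
transl⇒Tr V M (lam θ p s) e with transl V (θ ∷ M) p in e₁ | transl (θ ∷ V) M s in e₂
transl⇒Tr V M (lam θ p s) refl | just _ | just _ = lam (transl⇒Tr V (θ ∷ M) p e₁) (transl⇒Tr (θ ∷ V) M s e₂)

Tr⇒transl : ∀ {V M t t′} → Tr V M t t′ → transl V M t ≡ just t′
Tr⇒transl (var e) rewrite e = refl
Tr⇒transl (mat e) rewrite e = refl
Tr⇒transl (app t u) rewrite Tr⇒transl t | Tr⇒transl u = refl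
Tr⇒transl (lam p s) rewrite Tr⇒transl p | Tr⇒transl s = refl

Tr-isData : ∀ {V M t t′} → Tr V M t t′ → isDataD t′ ≡ isDataP t
Tr-isData (var _)   = refl
Tr-isData (mat _)   = refl
Tr-isData (app t _) = Tr-isData t
Tr-isData (lam _ _) = refl

Tr-isMatchable : ∀ {V M t t′} → Tr V M t t′ → isMatchableD t′ ≡ isMatchableP t
Tr-isMatchable (var _)   = refl
Tr-isMatchable (mat _)   = refl
Tr-isMatchable (app t _) = Tr-isData t
Tr-isMatchable (lam _ _) = refl

rawMatch-bound : ∀ θ x u → x ∈ θ → rawMatch θ (mat x) u ≡ sub ((x , u) ∷ [])
rawMatch-bound θ x u x∈θ rewrite SymKeys.memK-true x∈θ = refl

rawMatch-free : ∀ θ x y → x ∉ θ → rawMatch θ (mat x) (mat y) ≡ (if ⌊ x ℕ.≟ y ⌋ then sub [] else fail)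
rawMatch-free θ x y x∉θ rewrite SymKeys.memK-false x∉θ with ⌊ x ℕ.≟ y ⌋
... | true  = refl
... | false = refl

rawMatchD-free : ∀ n i j i′ j′ →
  rawMatchD n (m (suc (suc i)) j) (m i′ j′) ≡ (if ⌊ suc i ℕ.≟ i′ ⌋ ∧ ⌊ j ℕ.≟ j′ ⌋ then sub [] else fail)
rawMatchD-free n i j i′ j′ with ⌊ suc i ℕ.≟ i′ ⌋ ∧ ⌊ j ℕ.≟ j′ ⌋
... | true  = refl
... | false = refl

-- Two symbols of a context are equal iff their positions are: the
-- equality tests of clause 2 in PPC and in PPC_dB agree.
index2-same : ∀ Ls {x y i j i′ j′} → index2 x Ls ≡ just (i , j) → index2 y Ls ≡ just (i′ , j′) →
              ⌊ x ℕ.≟ y ⌋ ≡ ⌊ i ℕ.≟ i′ ⌋ ∧ ⌊ j ℕ.≟ j′ ⌋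
index2-same Ls {x} {y} {i} {j} {i′} {j′} ex ey = T-injective (mk⇔ same⇒ ⇒same)
  where
  same⇒ : T ⌊ x ℕ.≟ y ⌋ → T (⌊ i ℕ.≟ i′ ⌋ ∧ ⌊ j ℕ.≟ j′ ⌋)
  same⇒ x≡y with refl ← toWitness x≡y with refl ← trans (sym ex) ey =
    from T-∧ (fromWitness {a? = i ℕ.≟ i} refl , fromWitness {a? = j ℕ.≟ j} refl)
  ⇒same : T (⌊ i ℕ.≟ i′ ⌋ ∧ ⌊ j ℕ.≟ j′ ⌋) → T ⌊ x ℕ.≟ y ⌋
  ⇒same ij≡ with (i≡i′ , j≡j′) ← to T-∧ ij≡
                  with refl ← toWitness {a? = i ℕ.≟ i′} i≡i′ with refl ← toWitness {a? = j ℕ.≟ j′} j≡j′ =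
    fromWitness (index2-injective Ls ex ey)

module Simulation (θ : List Symbol) (V M : Ctx) where

  data TrSub : List (Symbol × Term) → List (DKey × DTerm) → Set where
    []   : TrSub [] []
    cons : ∀ {x t j t′ σ s} → indexOf x θ ≡ just j → Tr V M t t′ → TrSub σ s →
           TrSub ((x , t) ∷ σ) (((1 , j) , t′) ∷ s)

  data TrMatch : PMatch → DMatch → Set where
    fail : TrMatch fail fail
    wait : TrMatch wait wait
    sub  : ∀ {σ s} → TrSub σ s → TrMatch (sub σ) (sub s)

  TrSub-++ : ∀ {σ₁ σ₂ s₁ s₂} → TrSub σ₁ s₁ → TrSub σ₂ s₂ → TrSub (σ₁ ++ σ₂) (s₁ ++ s₂)
  TrSub-++ []              r₂ = r₂
  TrSub-++ (cons ex et r₁) r₂ = cons ex et (TrSub-++ r₁ r₂)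

  TrSub-key⇒ : ∀ {σ s x j} → TrSub σ s → indexOf x θ ≡ just j → x ∈ keys ℕ._≟_ σ → (1 , j) ∈ keys dkey-≟ s
  TrSub-key⇒ (cons ey _ r) ex (here refl) rewrite just-injective (trans (sym ex) ey) = here refl
  TrSub-key⇒ (cons _ _ r)  ex (there x∈σ) = there (TrSub-key⇒ r ex x∈σ)

  TrSub-key⇐ : ∀ {σ s k} → TrSub σ s → k ∈ keys dkey-≟ s →
               ∃[ x ] ∃[ j ] x ∈ keys ℕ._≟_ σ × indexOf x θ ≡ just j × k ≡ (1 , j)
  TrSub-key⇐ (cons {x = x} {j = j} ex _ r) (here refl) = x , j , here refl , ex , refl
  TrSub-key⇐ (cons _ _ r) (there k∈s) =
    let x , j , x∈σ , ex , k≡ = TrSub-key⇐ r k∈s in x , j , there x∈σ , ex , k≡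

  TrSub-key⇔ : ∀ {σ s x j} → TrSub σ s → indexOf x θ ≡ just j → x ∈ keys ℕ._≟_ σ ⇔ (1 , j) ∈ keys dkey-≟ s
  TrSub-key⇔ {σ} {s} {x} {j} r ex = mk⇔ (TrSub-key⇒ r ex) from-dB
    where
    from-dB : (1 , j) ∈ keys dkey-≟ s → x ∈ keys ℕ._≟_ σ
    from-dB k∈s with TrSub-key⇐ r k∈s
    ... | y , _ , y∈σ , ey , refl rewrite indexOf-injective θ ex ey = y∈σ

  TrSub-intersects : ∀ {σ₁ s₁ σ₂ s₂} → TrSub σ₁ s₁ → TrSub σ₂ s₂ →
                     intersects ℕ._≟_ σ₁ σ₂ ≡ intersects dkey-≟ s₁ s₂
  TrSub-intersects []              r₂ = refl
  TrSub-intersects {(x , _) ∷ _} {((_ , j) , _) ∷ _} {σ₂} {s₂} (cons ex _ r₁) r₂ =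
    cong₂ _∨_ key-clash (TrSub-intersects r₁ r₂)
    where
    key-clash : memK {T = Term} ℕ._≟_ x (keys ℕ._≟_ σ₂) ≡ memK {T = DTerm} dkey-≟ (1 , j) (keys dkey-≟ s₂)
    key-clash = T-injective (⇔-trans SymKeys.memK⇔∈ (⇔-trans (TrSub-key⇔ r₂ ex) (⇔-sym DKeys.memK⇔∈)))

  TrMatch-union : ∀ {μ₁ d₁ μ₂ d₂} → TrMatch μ₁ d₁ → TrMatch μ₂ d₂ →
                  TrMatch (union ℕ._≟_ μ₁ μ₂) (union dkey-≟ d₁ d₂)
  TrMatch-union fail    _       = fail
  TrMatch-union wait    fail    = fail
  TrMatch-union wait    wait    = wait
  TrMatch-union wait    (sub _) = wait
  TrMatch-union (sub _) fail    = fail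
  TrMatch-union (sub _) wait    = wait
  TrMatch-union (sub {σ₁} {s₁} r₁) (sub {σ₂} {s₂} r₂)
    rewrite TrSub-intersects r₁ r₂ with intersects dkey-≟ s₁ s₂
  ... | true  = fail
  ... | false = sub (TrSub-++ r₁ r₂)

  TrMatch-if : ∀ {b b′ μ d μ′ d′} → b ≡ b′ → TrMatch μ d → TrMatch μ′ d′ →
               TrMatch (if b then μ else μ′) (if b′ then d else d′)
  TrMatch-if {true}  refl r _ = r
  TrMatch-if {false} refl _ r = r

  -- The simulation: raw PPC_dB matching of translated terms computes the
  -- translation of raw PPC matching (for every n, which rawMatchD ignores).
  simulate : ∀ n {p u p′ u′} → Tr V (θ ∷ M) p p′ → Tr V M u u′ → TrMatch (rawMatch θ p u) (rawMatchD n p′ u′)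
  simulate n (var _)   tu        = wait
  simulate n (lam _ _) tu        = TrMatch-if (sym (Tr-isMatchable tu)) fail wait
  simulate n (app tp _) (var _)   = TrMatch-if (cong (_∧ false) (sym (Tr-isData tp))) fail wait
  simulate n (app tp _) (mat _)   = TrMatch-if (cong (_∧ true) (sym (Tr-isData tp))) fail wait
  simulate n (app tp _) (lam _ _) = TrMatch-if (cong (_∧ true) (sym (Tr-isData tp))) fail wait
  simulate n (app tp tq) (app tt tu) =
    TrMatch-if (cong₂ _∧_ (sym (Tr-isData tp)) (sym (Tr-isData tt)))
               (TrMatch-union (simulate n tp tt) (simulate n tq tu)) wait
  simulate n {mat x} {u} (mat {j = j} e) tu with index2-cons x θ M e
  ... | inj₁ (x-at-θ , refl) rewrite rawMatch-bound θ x u (indexOf⇒∈ x θ x-at-θ) = sub (cons x-at-θ tu [])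
  ... | inj₂ (x-not-at-θ , i₀ , x-at-M , refl) = free tu
    where
    x∉ : x ∉ θ
    x∉ = indexOf-nothing⇒∉ x-not-at-θ
    free : ∀ {u u′} → Tr V M u u′ → TrMatch (rawMatch θ (mat x) u) (rawMatchD n (m (suc (suc i₀)) j) u′)
    free (var _)   rewrite SymKeys.memK-false x∉ = wait
    free (app tt _) rewrite SymKeys.memK-false x∉ = TrMatch-if (sym (Tr-isData tt)) fail wait
    free (lam _ _) rewrite SymKeys.memK-false x∉ = fail
    free (mat {y} {i′} {j′} y-at-M) rewrite rawMatch-free θ x y x∉ | rawMatchD-free n i₀ j i′ j′ =
      TrMatch-if (index2-same M x-at-M y-at-M) (sub []) fail

-- The domain check and the comparison with transSub; both need θ to be
-- duplicate-free.
module Agreement (θ : List Symbol) (V M : Ctx) (θ-unique : Unique θ) where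
  open Simulation θ V M

  n : ℕ
  n = length θ

  TrSub-keys⊆θ : ∀ {σ s} → TrSub σ s → keys ℕ._≟_ σ ⊆ θ
  TrSub-keys⊆θ (cons {x = x} ex _ r) (here refl) = indexOf⇒∈ x θ ex
  TrSub-keys⊆θ (cons _ _ r) (there x∈σ) = TrSub-keys⊆θ r x∈σ

  TrSub-keys⊆firstKeys : ∀ {σ s} → TrSub σ s → keys dkey-≟ s ⊆ firstKeys n
  TrSub-keys⊆firstKeys r k∈s with TrSub-key⇐ r k∈s
  ... | x , j , _ , ex , refl = let 1≤j , j≤n = indexOf-bounds x θ ex in firstKeys-∋ n 1≤j j≤n

  TrSub-covers : ∀ {σ s} → TrSub σ s → θ ⊆ keys ℕ._≟_ σ ⇔ firstKeys n ⊆ keys dkey-≟ s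
  TrSub-covers {σ} {s} r = mk⇔ covers⇒ covers⇐
    where
    covers⇒ : θ ⊆ keys ℕ._≟_ σ → firstKeys n ⊆ keys dkey-≟ s
    covers⇒ θ⊆σ k∈ with firstKeys-∈ n k∈
    ... | j , refl , 1≤j , j≤n with x , ex ← indexOf-surjective θ-unique j 1≤j j≤n =
      TrSub-key⇒ r ex (θ⊆σ (indexOf⇒∈ x θ ex))
    covers⇐ : firstKeys n ⊆ keys dkey-≟ s → θ ⊆ keys ℕ._≟_ σ
    covers⇐ fk⊆s {x} x∈θ with j , ex ← ∈⇒indexOf x∈θ =
      let 1≤j , j≤n = indexOf-bounds x θ ex in
      from (TrSub-key⇔ r ex) (fk⊆s (firstKeys-∋ n 1≤j j≤n))

  TrSub-sameDom : ∀ {σ s} → TrSub σ s → sameDom ℕ._≟_ σ θ ≡ sameDom dkey-≟ s (firstKeys n)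
  TrSub-sameDom {σ} {s} r = T-injective (⇔-trans SymKeys.sameDom⇔ (⇔-trans (mk⇔ to-dB from-dB) (⇔-sym DKeys.sameDom⇔)))
    where
    to-dB : keys ℕ._≟_ σ ⊆ θ × θ ⊆ keys ℕ._≟_ σ → keys dkey-≟ s ⊆ firstKeys n × firstKeys n ⊆ keys dkey-≟ s
    to-dB (_ , θ⊆σ) = TrSub-keys⊆firstKeys r , to (TrSub-covers r) θ⊆σ
    from-dB : keys dkey-≟ s ⊆ firstKeys n × firstKeys n ⊆ keys dkey-≟ s → keys ℕ._≟_ σ ⊆ θ × θ ⊆ keys ℕ._≟_ σ
    from-dB (_ , fk⊆s) = TrSub-keys⊆θ r , from (TrSub-covers r) fk⊆s

  TrMatch-checkDom : ∀ {μ d} → TrMatch μ d → TrMatch (checkDom ℕ._≟_ θ μ) (checkDom dkey-≟ (firstKeys n) d)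
  TrMatch-checkDom fail    = fail
  TrMatch-checkDom wait    = wait
  TrMatch-checkDom (sub r) = TrMatch-if (TrSub-sameDom r) (sub r) fail

  -- expected σ j₀ θ′ k is the value of T_{V,M}(σ)_{θ′} at the key k when
  -- the symbols of θ′ are numbered from j₀: v_{1,j} receives the
  -- translation of σ at the j-th symbol, every other key nothing.
  expected : List (Symbol × Term) → ℕ → List Symbol → DKey → Maybe DTerm
  expected σ j₀ θ′ (suc zero , j) = nthFrom j₀ θ′ j >>= lookupK ℕ._≟_ σ >>= transl V M
  expected σ j₀ θ′ _              = nothing

  expected-head : ∀ σ j₀ x θ′ → expected σ j₀ (x ∷ θ′) (1 , j₀) ≡ (lookupK ℕ._≟_ σ x >>= transl V M)
  expected-head σ j₀ x θ′ rewrite if-true {x = just x} {y = nthFrom (suc j₀) θ′ j₀} (≡⇒≡ᵇ j₀ j₀ refl) = refl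

  expected-tail : ∀ σ j₀ x θ′ k → k ≢ (1 , j₀) → expected σ (suc j₀) θ′ k ≡ expected σ j₀ (x ∷ θ′) k
  expected-tail σ j₀ x θ′ (zero , j)        _   = refl
  expected-tail σ j₀ x θ′ (suc (suc i) , j) _   = refl
  expected-tail σ j₀ x θ′ (suc zero , j)    k≢ rewrite if-false {x = just x} {y = nthFrom (suc j₀) θ′ j}
                                                         (λ j≡j₀ → k≢ (cong (1 ,_) (≡ᵇ⇒≡ j j₀ j≡j₀))) = refl

  lookup-transSub : ∀ σ j₀ θ′ {τ} → transSubAux V M σ j₀ θ′ ≡ just τ → ∀ k → lookupK dkey-≟ τ k ≡ expected σ j₀ θ′ k
  lookup-transSub σ j₀ []       refl (zero , j)        = refl
  lookup-transSub σ j₀ []       refl (suc zero , j)    = refl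
  lookup-transSub σ j₀ []       refl (suc (suc i) , j) = refl
  lookup-transSub σ j₀ (x ∷ θ′) {τ} e k with lookupK ℕ._≟_ σ x in x↦
  ... | nothing = skipped (dkey-≟ k (1 , j₀))
    where
    skipped : Dec (k ≡ (1 , j₀)) → lookupK dkey-≟ τ k ≡ expected σ j₀ (x ∷ θ′) k
    skipped (yes refl) = begin
      lookupK dkey-≟ τ (1 , j₀)          ≡⟨ lookup-transSub σ (suc j₀) θ′ e (1 , j₀) ⟩
      expected σ (suc j₀) θ′ (1 , j₀)    ≡⟨ cong (λ y → y >>= lookupK ℕ._≟_ σ >>= transl V M) (nthFrom-below (suc j₀) θ′ j₀ ≤-refl) ⟩
      nothing                            ≡⟨ cong (_>>= transl V M) x↦ ⟨
      (lookupK ℕ._≟_ σ x >>= transl V M) ≡⟨ expected-head σ j₀ x θ′ ⟨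
      expected σ j₀ (x ∷ θ′) (1 , j₀)    ∎
    skipped (no k≢) = trans (lookup-transSub σ (suc j₀) θ′ e k) (expected-tail σ j₀ x θ′ k k≢)
  ... | just t with transl V M t in t↦ | transSubAux V M σ (suc j₀) θ′ in rest
  lookup-transSub σ j₀ (x ∷ θ′) refl k | just t | just t′ | just τ = entry (dkey-≟ k (1 , j₀))
    where
    entry : Dec (k ≡ (1 , j₀)) → lookupK dkey-≟ (((1 , j₀) , t′) ∷ τ) k ≡ expected σ j₀ (x ∷ θ′) k
    entry (yes refl) = begin
      lookupK dkey-≟ (((1 , j₀) , t′) ∷ τ) (1 , j₀) ≡⟨ DKeys.lookupK-here τ ⟩
      just t′                                       ≡⟨ t↦ ⟨
      transl V M t                                  ≡⟨ cong (_>>= transl V M) x↦ ⟨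
      (lookupK ℕ._≟_ σ x >>= transl V M)            ≡⟨ expected-head σ j₀ x θ′ ⟨
      expected σ j₀ (x ∷ θ′) (1 , j₀)               ∎
    entry (no k≢) = begin
      lookupK dkey-≟ (((1 , j₀) , t′) ∷ τ) k ≡⟨ DKeys.lookupK-there τ k≢ ⟩
      lookupK dkey-≟ τ k                     ≡⟨ lookup-transSub σ (suc j₀) θ′ rest k ⟩
      expected σ (suc j₀) θ′ k               ≡⟨ expected-tail σ j₀ x θ′ k k≢ ⟩
      expected σ j₀ (x ∷ θ′) k               ∎

  expected-extend : ∀ {x t j} σ k → indexOf x θ ≡ just j → k ≢ (1 , j) →
                    expected σ 1 θ k ≡ expected ((x , t) ∷ σ) 1 θ k
  expected-extend σ (zero , _)        _  _  = refl
  expected-extend σ (suc (suc _) , _) _  _  = refl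
  expected-extend {x} σ (suc zero , j′) ex k≢ with nthFrom 1 θ j′ in y↦
  ... | nothing = refl
  ... | just y  = cong (_>>= transl V M) (sym (SymKeys.lookupK-there σ y≢x))
    where
    y≢x : y ≢ x
    y≢x refl = k≢ (cong (1 ,_) (just-injective (trans (sym (nth⇒indexOf θ-unique j′ y↦)) ex)))

  lookup-TrSub : ∀ {σ s} → TrSub σ s → ∀ k → lookupK dkey-≟ s k ≡ expected σ 1 θ k
  lookup-TrSub [] (zero , j)        = refl
  lookup-TrSub [] (suc (suc i) , j) = refl
  lookup-TrSub [] (suc zero , j) with nthFrom 1 θ j
  ... | just _  = refl
  ... | nothing = refl
  lookup-TrSub {(x , t) ∷ σ} {((_ , j) , t′) ∷ s} (cons ex et r) k = entry (dkey-≟ k (1 , j))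
    where
    entry : Dec (k ≡ (1 , j)) → lookupK dkey-≟ (((1 , j) , t′) ∷ s) k ≡ expected ((x , t) ∷ σ) 1 θ k
    entry (yes refl) = begin
      lookupK dkey-≟ (((1 , j) , t′) ∷ s) (1 , j)       ≡⟨ DKeys.lookupK-here s ⟩
      just t′                                           ≡⟨ Tr⇒transl et ⟨
      transl V M t                                      ≡⟨ cong (_>>= transl V M) (SymKeys.lookupK-here {x} σ) ⟨
      (lookupK ℕ._≟_ ((x , t) ∷ σ) x >>= transl V M)    ≡⟨ cong (λ y → y >>= lookupK ℕ._≟_ ((x , t) ∷ σ) >>= transl V M)
                                                                (indexOf⇒nth x θ ex) ⟨
      expected ((x , t) ∷ σ) 1 θ (1 , j)                ∎
    entry (no k≢) = begin
      lookupK dkey-≟ (((1 , j) , t′) ∷ s) k ≡⟨ DKeys.lookupK-there s k≢ ⟩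
      lookupK dkey-≟ s k                    ≡⟨ lookup-TrSub r k ⟩
      expected σ 1 θ k                      ≡⟨ expected-extend σ k ex k≢ ⟩
      expected ((x , t) ∷ σ) 1 θ k          ∎

  TrSub≈transSub : ∀ {σ s τ} → TrSub σ s → transSub V M σ θ ≡ just τ → _≈M_ dkey-≟ (sub s) (sub τ)
  TrSub≈transSub {σ} r eτ = sub≈ λ k → trans (lookup-TrSub r k) (sym (lookup-transSub σ 1 θ eτ k))

lemma4p5 : (θ : List Symbol) (V M : List (List Symbol)) (p u : Term) (p' u' : DTerm) →
    Unique θ →
    transl V (θ ∷ M) p ≡ just p' →
    transl V M u ≡ just u' →
    ((σ : List (Symbol × Term)) → match θ p u ≡ sub σ →
       (τ : List (DKey × DTerm)) → transSub V M σ θ ≡ just τ →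
       _≈M_ dkey-≟ (matchD (length θ) p' u') (sub τ))
    × (match θ p u ≡ fail → matchD (length θ) p' u' ≡ fail)
    × (match θ p u ≡ wait → matchD (length θ) p' u' ≡ wait)
lemma4p5 θ V M p u p' u' θ-unique p↦ u↦ = substitution-case related , fail-case related , wait-case related
  where
  open Simulation θ V M
  open Agreement θ V M θ-unique

  related : TrMatch (match θ p u) (matchD (length θ) p' u')
  related = TrMatch-checkDom (simulate (length θ) (transl⇒Tr V (θ ∷ M) p p↦) (transl⇒Tr V M u u↦))

  substitution-case : ∀ {μ d} → TrMatch μ d → (σ : List (Symbol × Term)) → μ ≡ sub σ →
                      (τ : List (DKey × DTerm)) → transSub V M σ θ ≡ just τ → _≈M_ dkey-≟ d (sub τ)
  substitution-case (sub r) σ refl τ eτ = TrSub≈transSub r eτ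

  fail-case : ∀ {μ d} → TrMatch μ d → μ ≡ fail → d ≡ fail
  fail-case fail refl = refl

  wait-case : ∀ {μ d} → TrMatch μ d → μ ≡ wait → d ≡ wait
  wait-case wait refl = refl
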